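{- Let $k,n$ be positive integers, $G\subseteq S_k$ a subgroup, and $I$ an order ideal of $B_{\mathbf{1}_G}(k,n)$. Then $C_I\cap\mathrm{Gr}_{\mathbf{1}_G}(k,n)\neq\varnothing$ if and only if $I$ is a principal order ideal. Consequently the poset (under inclusion) of order ideals $I$ with $C_I\cap\mathrm{Gr}_{\mathbf{1}_G}(k,n)\neq\varnothing$ is isomorphic to $B_{\mathbf{1}_G}(k,n)$.
   Context: $V=\mathbb{C}^n$ with basis $e_1,\dots,e_n$, $e_x=e_{x_1}\otimes\cdots\otimes e_{x_k}$; $S_k$ acts on $[n]^k$ by $w(x)=(x_{w^{ -1}(1)},\dots,x_{w^{ -1}(k)})$ and on $V^{\otimes k}$ by $w(e_x)=e_{w(x)}$, inducing $P\mapsto P^{(n)}$ from $\mathbb{C}[S_k]$. $P_{\mathbf{1}_G}=\frac1{|G|}\sum_{g\in G}g$, $V^{\otimes k}_{\mathbf{1}_G}=\mathrm{Im}(P^{(n)}_{\mathbf{1}_G})$, and $\mathrm{Gr}_{\mathbf{1}_G}(k,n)=\{[P^{(n)}_{\mathbf{1}_G}(v_1\otimes\cdots\otimes v_k)]:v_i\in V\setminus\{0\}\}\subseteq\mathbb{P}(V^{\otimes k}_{\mathbf{1}_G})$. For $x\in[n]^k$, $\overline x$ is the lexicographic minimum of $\{g(x):g\in G\}$; $B_{\mathbf{1}_G}(k,n)=\{\overline x:x\in[n]^k\}$ ordered by $x\preccurlyeq y$ iff $x\leqslant g(y)$ componentwise for some $g\in G$. The vectors $P^{(n)}_{\mathbf{1}_G}(e_x)$,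 $x\in B_{\mathbf{1}_G}(k,n)$, form a basis of $V^{\otimes k}_{\mathbf{1}_G}$. For a subset $I\subseteq B_{\mathbf{1}_G}(k,n)$ let $V_I=\mathrm{span}\{P^{(n)}_{\mathbf{1}_G}(e_x):x\in I\}$, and for an order ideal $I$ let $C_I=\mathbb{P}(V_I)\setminus\bigcup_{i\in\max(I)}\mathbb{P}(V_{I\setminus\{i\}})$ (these are the orbits of the group of invertible matrices in the incidence algebra of $B_{\mathbf{1}_G}(k,n)$ acting on $\mathbb{P}(V^{\otimes k}_{\mathbf{1}_G})$). A principal order ideal is one of the form $x^\downarrow=\{y:y\preccurlyeq x\}$. -}

module Defs where

open import Level using (Level; _⊔_; suc; 0ℓ)
open import Data.Nat as ℕ using (ℕ; zero)
open import Data.Fin using (Fin; _<_; _≤_)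
open import Data.Fin.Permutation using (Permutation′; _⟨$⟩ʳ_; _⟨$⟩ˡ_; _∘ₚ_)
open import Data.Fin.Permutation using () renaming (id to idₚ)
open import Data.List using (List; []; _∷_; length)
open import Data.List.Membership.Propositional using (_∈_)
open import Data.List.Relation.Unary.AllPairs using (AllPairs)
open import Data.Product using (Σ; _×_; _,_; ∃; ∃-syntax)
open import Data.Sum using (_⊎_)
open import Relation.Nullary using (¬_; Dec; yes; no)
open import Relation.Binary.PropositionalEquality using (_≡_)
open import Algebra.Bundles using (CommutativeRing)
open import Data.Fin.Properties using (all?; _≟_)

record Field (c ℓ : Level) : Set (suc (c ⊔ ℓ)) where
  field
    commutativeRing : CommutativeRing c ℓ
  open CommutativeRing commutativeRing public
  field
    _⁻¹      : (x : Carrier) → ¬ (x ≈ 0#) → Carrier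
    inverse  : (x : Carrier) (x≉0 : ¬ (x ≈ 0#)) → x * (x ⁻¹) x≉0 ≈ 1#
    1≉0      : ¬ (1# ≈ 0#)

-- Words x ∈ [n]^k (indices 1..n and 1..k are Fin n, Fin k)

Word : ℕ → ℕ → Set
Word k n = Fin k → Fin n

_≗w_ : ∀ {k n} → Word k n → Word k n → Set
x ≗w y = ∀ i → x i ≡ y i

_≗w?_ : ∀ {k n} (x y : Word k n) → Dec (x ≗w y)
x ≗w? y = all? (λ i → x i ≟ y i)

act : ∀ {k n} → Permutation′ k → Word k n → Word k n
act w x = λ i → x (w ⟨$⟩ˡ i)

_≈ₚ_ : ∀ {k} → Permutation′ k → Permutation′ k → Set
π ≈ₚ σ = ∀ i → π ⟨$⟩ʳ i ≡ σ ⟨$⟩ʳ i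

record Subgroup (k : ℕ) : Set where
  field
    elems    : List (Permutation′ k)
    distinct : AllPairs (λ π σ → ¬ (π ≈ₚ σ)) elems
    has-id   : ∃[ τ ] (τ ∈ elems × τ ≈ₚ idₚ)
    closed   : ∀ {π σ} → π ∈ elems → σ ∈ elems →
               ∃[ τ ] (τ ∈ elems × τ ≈ₚ (π ∘ₚ σ))
    closed⁻¹ : ∀ {π} → π ∈ elems →
               ∃[ τ ] (τ ∈ elems × ∀ i → τ ⟨$⟩ʳ (π ⟨$⟩ʳ i) ≡ i)

  order : ℕ
  order = length elems

module _ {k n : ℕ} (G : Subgroup k) where
  open Subgroup G

  _<lex_ : Word k n → Word k n → Set
  x <lex y = ∃[ i ] ((∀ j → j < i → x j ≡ y j) × x i < y i)

  _≤lex_ : Word k n → Word k n → Set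
  x ≤lex y = x <lex y ⊎ x ≗w y

  -- x ∈ B_{1_G}(k,n) iff x is the lexicographic minimum of its G-orbit,
  -- i.e. x = x̄
  InB : Word k n → Set
  InB x = ∀ g → g ∈ elems → x ≤lex act g x

  _≼_ : Word k n → Word k n → Set
  x ≼ y = ∃[ g ] (g ∈ elems × ∀ i → x i ≤ act g y i)

  SubsetB : (Word k n → Set) → Set
  SubsetB I = ∀ x → I x → InB x

  IsOrderIdeal : (Word k n → Set) → Set
  IsOrderIdeal I = SubsetB I × (∀ x y → InB x → I y → x ≼ y → I x)

  _↓ : Word k n → Word k n → Set
  (x ↓) y = InB y × y ≼ x

  IsPrincipal : (Word k n → Set) → Set
  IsPrincipal I = ∃[ x ] (InB x × (∀ y → InB y → (I y → (x ↓) y) × ((x ↓) y → I y)))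

  IsMax : (Word k n → Set) → Word k n → Set
  IsMax I i = I i × (∀ j → I j → i ≼ j → j ≼ i)

  remove : (Word k n → Set) → Word k n → Word k n → Set
  remove I i j = I j × ¬ (j ≗w i)

module LinAlg {c ℓ : Level} (F : Field c ℓ) where
  open Field F

  fromℕ : ℕ → Carrier
  fromℕ zero       = 0#
  fromℕ (ℕ.suc m)  = 1# + fromℕ m

  CharZero : Set ℓ
  CharZero = ∀ m → ¬ (fromℕ (ℕ.suc m) ≈ 0#)

  Vec′ : ℕ → Set c
  Vec′ n = Fin n → Carrier

  NonZero : ∀ {m} → (Fin m → Carrier) → Set ℓ
  NonZero v = ∃[ i ] ¬ (v i ≈ 0#)

  -- V^{⊗k}, tensors as coordinate functions w.r.t. the basis e_x, x ∈ [n]^k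
  Tensor : ℕ → ℕ → Set c
  Tensor k n = Word k n → Carrier

  NonZeroT : ∀ {k n} → Tensor k n → Set ℓ
  NonZeroT T = ∃[ x ] ¬ (T x ≈ 0#)

  e : ∀ {k n} → Word k n → Tensor k n
  e x y with x ≗w? y
  ... | yes _ = 1#
  ... | no  _ = 0#

  prodFin : ∀ k → (Fin k → Carrier) → Carrier
  prodFin zero      f = 1#
  prodFin (ℕ.suc k) f = f Fin.zero * prodFin k (λ i → f (Fin.suc i))
    where import Data.Fin as Fin

  ⊗ : ∀ {k n} → (Fin k → Vec′ n) → Tensor k n
  ⊗ {k} v x = prodFin k (λ i → v i (x i))

  -- action of w ∈ S_k on V^{⊗k} extending w(e_x) = e_{w(x)}:
  -- (w T)(y) = T(w⁻¹(y))
  actT : ∀ {k n} → Permutation′ k → Tensor k n → Tensor k n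
  actT w T y = T (act (Data.Fin.Permutation.flip w) y)
    where import Data.Fin.Permutation

  _+T_ : ∀ {k n} → Tensor k n → Tensor k n → Tensor k n
  (S +T T) x = S x + T x

  _·T_ : ∀ {k n} → Carrier → Tensor k n → Tensor k n
  (a ·T T) x = a * T x

  0T : ∀ {k n} → Tensor k n
  0T _ = 0#

  _≈T_ : ∀ {k n} → Tensor k n → Tensor k n → Set ℓ
  S ≈T T = ∀ x → S x ≈ T x

  sumPerm : ∀ {k n} → List (Permutation′ k) → Tensor k n → Tensor k n
  sumPerm []       T = 0T
  sumPerm (g ∷ gs) T = actT g T +T sumPerm gs T

  order≉0 : CharZero → ∀ {k} (G : Subgroup k) → ¬ (fromℕ (Subgroup.order G) ≈ 0#)
  order≉0 cz G = lemma (Subgroup.elems G) (Data.Product.proj₁ (Data.Product.proj₂ (Subgroup.has-id G)))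
    where
    import Data.Product
    lemma : ∀ {A : Set} {a : A} (xs : List A) → a ∈ xs → ¬ (fromℕ (length xs) ≈ 0#)
    lemma (x ∷ xs) _ = cz (length xs)

  module Sym (cz : CharZero) {k n : ℕ} (G : Subgroup k) where
    open Subgroup G

    P : Tensor k n → Tensor k n
    P T = ((fromℕ order ⁻¹) (order≉0 cz G)) ·T sumPerm elems T

    b : Word k n → Tensor k n
    b x = P (e x)

    lincomb : List (Word k n) → (Word k n → Carrier) → Tensor k n
    lincomb []       c = 0T
    lincomb (x ∷ xs) c = (c x ·T b x) +T lincomb xs c

    InSpan : (Word k n → Set) → Tensor k n → Set (c ⊔ ℓ)
    InSpan J T = ∃[ L ] ∃[ coef ]
      ((∀ x → x ∈ L → J x) × T ≈T lincomb L coef)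

    -- the projective point [T] lies in C_I
    InC : (Word k n → Set) → Tensor k n → Set (c ⊔ ℓ)
    InC I T = NonZeroT T × InSpan I T ×
              (∀ i → IsMax G I i → ¬ InSpan (remove G I i) T)

    MeetsGr : (Word k n → Set) → Set (c ⊔ ℓ)
    MeetsGr I = ∃[ v ] ((∀ i → NonZero (v i)) × InC I (P (⊗ v)))

record OrderIso {a b ℓ₁ ℓ₂ ℓ₃ ℓ₄}
  (A : Set a) (_≈A_ : A → A → Set ℓ₁) (_≤A_ : A → A → Set ℓ₂)
  (B : Set b) (_≈B_ : B → B → Set ℓ₃) (_≤B_ : B → B → Set ℓ₄)
  : Set (a ⊔ b ⊔ ℓ₁ ⊔ ℓ₂ ⊔ ℓ₃ ⊔ ℓ₄) where
  field
    to       : A → B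
    from     : B → A
    from-to  : ∀ x → from (to x) ≈A x
    to-from  : ∀ y → to (from y) ≈B y
    mono     : ∀ x y → x ≤A y → to x ≤B to y
    reflect  : ∀ x y → to x ≤B to y → x ≤A y

module Submission where

-- For nonzero v₁, …, v_k let μᵢ be the last index with vᵢ(μᵢ) ≠ 0. A term of
-- v₁ ⊗ ⋯ ⊗ v_k vanishes unless its word lies componentwise below μ, so P(⊗v)
-- vanishes off the words ≼ μ, while its μ-coordinate is a nonzero multiple of the
-- order of the stabiliser of μ. If [P(⊗v)] ∈ C_I, a maximal element of I that is
-- not ≼ μ could be dropped from the spanning set; hence I = μ̄↓. Conversely, for
-- vᵢ = e₁ + ⋯ + e_{xᵢ} the tensor P(⊗v) is G-invariant and supported on the orbits
-- of x↓, so it lies in V_{x↓}, but not in V_{x↓∖{x}} because its x-coordinate is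
-- nonzero. Constructively μ and maximal elements exist only under double negation;
-- this suffices, as everything else is decided by finite search.

open import Defs
open import Level using (Level; 0ℓ; _⊔_)
open import Data.Nat as ℕ using (ℕ; zero; suc; _≤_; _<_)
import Data.Nat.Properties as ℕP
open import Data.Fin as Fin using (Fin; toℕ) renaming (_≤_ to _≤ᶠ_; _<_ to _<ᶠ_)
import Data.Fin.Properties as FinP
open import Data.Fin.Permutation as Perm using (Permutation′; _⟨$⟩ʳ_; _⟨$⟩ˡ_; inverseˡ; inverseʳ)
open import Data.List using (List; []; _∷_; length; lookup; filter; map; concatMap; allFin; deduplicate)
open import Data.List.Membership.Propositional using (_∈_; find; lose)
open import Data.List.Membership.Propositional.Properties
  using (∈-filter⁻; ∈-filter⁺; ∈-lookup; ∈-concatMap⁺; ∈-map⁺; ∈-map⁻; ∈-allFin)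
open import Data.List.Relation.Unary.Any as Any using (Any; here; there; any?)
open import Data.List.Relation.Unary.Any.Properties using (lookup-index; deduplicate⁺)
open import Data.List.Relation.Unary.All as All using (All; all?)
open import Data.List.Relation.Unary.AllPairs using (AllPairs; []; _∷_)
open import Data.Product using (Σ; _×_; _,_; ∃; ∃-syntax; proj₁; proj₂; swap)
open import Data.Sum using (_⊎_; inj₁; inj₂)
open import Data.Empty using (⊥-elim)
open import Function using (_∘_; id)
open import Function.Bundles using (_⇔_; mk⇔)
open import Relation.Nullary using (¬_; Dec; yes; no; ¬?; _×-dec_; ¬¬-map)
import Relation.Nullary.Decidable
open import Relation.Nullary.Decidable using (decidable-stable; ¬¬-excluded-middle)
open import Relation.Unary using (Pred; Decidable)
open import Relation.Binary using (tri<; tri≈; tri>; Trichotomous; StrictTotalOrder; DecTotalOrder; Setoid)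
import Relation.Binary.Properties.StrictTotalOrder as StrictTotalOrderProperties
import Data.List.Extrema as Extrema
import Data.List.Relation.Unary.Unique.DecSetoid.Properties as UniqueProperties
import Data.List.Relation.Unary.Unique.Setoid.Properties as UniqueSetoid
open import Algebra.Bundles using (CommutativeMonoid)
open import Relation.Binary.PropositionalEquality as ≡ using (_≡_)
import Algebra.Properties.CommutativeMonoid.Sum as CommutativeMonoidSum

module ℕΣ = CommutativeMonoidSum ℕP.+-0-commutativeMonoid

sum-mono-≤ : ∀ {m} {a b : Fin m → ℕ} → (∀ i → a i ≤ b i) → ℕΣ.sum a ≤ ℕΣ.sum b
sum-mono-≤ {zero}  a≤b = ℕ.z≤n
sum-mono-≤ {suc m} a≤b = ℕP.+-mono-≤ (a≤b Fin.zero) (sum-mono-≤ (a≤b ∘ Fin.suc))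

sum-mono-≤-≡⇒≡ : ∀ {m} {a b : Fin m → ℕ} → (∀ i → a i ≤ b i) →
                 ℕΣ.sum a ≡ ℕΣ.sum b → ∀ i → a i ≡ b i
sum-mono-≤-≡⇒≡ {suc m} {a} {b} a≤b sa≡sb = λ where
    Fin.zero    → head≡
    (Fin.suc i) → sum-mono-≤-≡⇒≡ (a≤b ∘ Fin.suc)
                    (ℕP.+-cancelˡ-≡ (a Fin.zero) _ _ (≡.trans sa≡sb (≡.cong (ℕ._+ _) (≡.sym head≡)))) i
  where
  head≡ : a Fin.zero ≡ b Fin.zero
  head≡ = ℕP.≤-antisym (a≤b Fin.zero) (ℕP.+-cancelʳ-≤ _ _ _ (ℕP.≤-trans (ℕP.≤-reflexive (≡.sym sa≡sb))
            (ℕP.+-monoʳ-≤ (a Fin.zero) (sum-mono-≤ (a≤b ∘ Fin.suc)))))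

last-index : ∀ {n p} {P : Pred (Fin n) p} → Decidable P → ∃ P →
             ∃[ m ] (P m × ∀ j → m <ᶠ j → ¬ P j)
last-index {suc n} P? (j₀ , Pj₀) with FinP.any? (P? ∘ Fin.suc) | j₀ | Pj₀
... | yes witness | _ | _ with last-index (P? ∘ Fin.suc) witness
...   | m , Pm , above = Fin.suc m , Pm , λ where
          Fin.zero    ()
          (Fin.suc j) (ℕ.s≤s m<j) → above j m<j
last-index {suc n} P? _ | no none | Fin.zero    | P0 =
  Fin.zero , P0 , λ where
    Fin.zero    ()
    (Fin.suc j) _ Pj → none (j , Pj)
last-index {suc n} P? _ | no none | Fin.suc j | Pj = ⊥-elim (none (j , Pj))

¬¬-bind : ∀ {a b} {A : Set a} {B : Set b} → ¬ ¬ A → (A → ¬ ¬ B) → ¬ ¬ B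
¬¬-bind ¬¬a f ¬b = ¬¬a (λ a → f a ¬b)

¬¬-∀Fin : ∀ {p} m {P : Fin m → Set p} → (∀ i → ¬ ¬ P i) → ¬ ¬ (∀ i → P i)
¬¬-∀Fin zero    _   ¬all = ¬all (λ ())
¬¬-∀Fin (suc m) ¬¬P ¬all = ¬¬P Fin.zero λ P0 → ¬¬-∀Fin m (¬¬P ∘ Fin.suc) λ Ps →
  ¬all λ where
    Fin.zero    → P0
    (Fin.suc i) → Ps i

module BoundedHeight {a r} {A : Set a} (_⊑_ : A → A → Set r)
  (⊑-refl : ∀ {x} → x ⊑ x) (⊑-trans : ∀ {x y z} → x ⊑ y → y ⊑ z → x ⊑ z)
  (_⊑?_ : ∀ x y → Dec (x ⊑ y))
  (height : A → ℕ) (bound : ℕ) (height≤bound : ∀ x → height x ≤ bound)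
  (height-strict : ∀ {x y} → x ⊑ y → ¬ y ⊑ x → height x < height y) where

  IsMaximal : ∀ {p} → (A → Set p) → A → Set _
  IsMaximal I i = I i × (∀ j → I j → i ⊑ j → j ⊑ i)

  ¬¬-maximal-above : ∀ {p} (I : A → Set p) {z} → I z → ¬ ¬ (∃[ i ] (z ⊑ i × IsMaximal I i))
  ¬¬-maximal-above I {z} = go bound (ℕP.m≤n+m bound (height z))
    where
    Goal : A → Set _
    Goal z = ¬ ¬ (∃[ i ] (z ⊑ i × IsMaximal I i))
    go   : ∀ fuel {z} → bound ≤ height z ℕ.+ fuel → I z → Goal z
    step : ∀ fuel {z} → bound ≤ height z ℕ.+ fuel → I z → Dec (∃[ j ] (I j × z ⊑ j × ¬ j ⊑ z)) → Goal z
    go fuel enough Iz = ¬¬-bind ¬¬-excluded-middle (step fuel enough Iz)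
    step _ {z} _ Iz (no noneAbove) ¬max = ¬max (z , ⊑-refl , Iz , λ j Ij z⊑j →
      decidable-stable (j ⊑? z) λ j⋢z → noneAbove (j , Ij , z⊑j , j⋢z))
    step zero {z} enough _ (yes (j , _ , z⊑j , j⋢z)) = ⊥-elim (ℕP.<⇒≱ (height-strict z⊑j j⋢z)
      (ℕP.≤-trans (height≤bound j) (ℕP.≤-trans enough (ℕP.≤-reflexive (ℕP.+-identityʳ (height z))))))
    step (suc fuel) {z} enough _ (yes (j , Ij , z⊑j , j⋢z)) = ¬¬-bind
      (go fuel (ℕP.≤-trans enough (ℕP.≤-trans (ℕP.≤-reflexive (ℕP.+-suc (height z) fuel))
                                             (ℕP.+-monoˡ-≤ fuel (height-strict z⊑j j⋢z)))) Ij)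
      λ { (i , j⊑i , i-maximal) ¬goal → ¬goal (i , ⊑-trans z⊑j j⊑i , i-maximal) }

module SubgroupProperties {k} (G : Subgroup k) where
  open Subgroup G

  InG : (Fin k → Fin k) → Set
  InG f = ∃[ τ ] (τ ∈ elems × (∀ i → τ ⟨$⟩ʳ i ≡ f i))

  InG-resp : ∀ {f g} → InG f → (∀ i → f i ≡ g i) → InG g
  InG-resp (τ , τ∈G , τ≗f) f≗g = τ , τ∈G , λ i → ≡.trans (τ≗f i) (f≗g i)

  ⟨$⟩ʳ-InG : ∀ {g} → g ∈ elems → InG (g ⟨$⟩ʳ_)
  ⟨$⟩ʳ-InG {g} g∈G = g , g∈G , λ _ → ≡.refl

  InG-id : InG id
  InG-id = has-id

  InG-∘ : ∀ {f g} → InG f → InG g → InG (f ∘ g)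
  InG-∘ {f} {g} (τf , τf∈G , τf≗f) (τg , τg∈G , τg≗g) with closed τg∈G τf∈G
  ... | τ , τ∈G , τ≗ = τ , τ∈G , λ i →
        ≡.trans (τ≗ i) (≡.trans (≡.cong (τf ⟨$⟩ʳ_) (τg≗g i)) (τf≗f (g i)))

  record Inverse (f : Fin k → Fin k) : Set where
    field
      f⁻¹     : Fin k → Fin k
      f⁻¹-InG : InG f⁻¹
      f⁻¹∘f   : ∀ i → f⁻¹ (f i) ≡ i
      f∘f⁻¹   : ∀ i → f (f⁻¹ i) ≡ i

  InG-inverse : ∀ {f} → InG f → Inverse f
  InG-inverse {f} (τ , τ∈G , τ≗f) with closed⁻¹ τ∈G
  ... | τ′ , τ′∈G , τ′∘τ = record
    { f⁻¹     = τ′ ⟨$⟩ʳ_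
    ; f⁻¹-InG = ⟨$⟩ʳ-InG τ′∈G
    ; f⁻¹∘f   = λ i → ≡.trans (≡.cong (τ′ ⟨$⟩ʳ_) (≡.sym (τ≗f i))) (τ′∘τ i)
    ; f∘f⁻¹   = λ i → ≡.trans (≡.sym (τ≗f _)) (≡.trans (≡.cong (τ ⟨$⟩ʳ_) (τ′≗τ⁻¹ i)) (inverseʳ τ))
    }
    where
    τ′≗τ⁻¹ : ∀ j → τ′ ⟨$⟩ʳ j ≡ τ ⟨$⟩ˡ j
    τ′≗τ⁻¹ j = ≡.trans (≡.cong (τ′ ⟨$⟩ʳ_) (≡.sym (inverseʳ τ))) (τ′∘τ (τ ⟨$⟩ˡ j))

  InG⇒⟨$⟩ˡ : ∀ {f} → InG f → ∃[ g ] (g ∈ elems × (∀ i → g ⟨$⟩ˡ i ≡ f i))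
  InG⇒⟨$⟩ˡ {f} f∈G with InG-inverse f∈G
  ... | record { f⁻¹-InG = τ , τ∈G , τ≗f⁻¹ ; f⁻¹∘f = f⁻¹∘f } = τ , τ∈G , λ i →
        ≡.trans (≡.cong (τ ⟨$⟩ˡ_) (≡.trans (≡.sym (f⁻¹∘f i)) (≡.sym (τ≗f⁻¹ (f i))))) (inverseˡ τ)

  ⟨$⟩ˡ-InG : ∀ {g} → g ∈ elems → InG (g ⟨$⟩ˡ_)
  ⟨$⟩ˡ-InG {g} g∈G = InG-resp f⁻¹-InG λ i → ≡.trans (≡.cong f⁻¹ (≡.sym (inverseʳ g))) (f⁻¹∘f (g ⟨$⟩ˡ i))
    where open Inverse (InG-inverse (⟨$⟩ʳ-InG g∈G))

module ListSum {c ℓ} (M : CommutativeMonoid c ℓ) where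
  open CommutativeMonoid M
  open import Relation.Binary.Reasoning.Setoid setoid
  private module MΣ = CommutativeMonoidSum M

  lsum : ∀ {a} {A : Set a} → List A → (A → Carrier) → Carrier
  lsum []       φ = ε
  lsum (x ∷ xs) φ = φ x ∙ lsum xs φ

  module _ {a} {A : Set a} where

    lsum-cong : ∀ (xs : List A) {φ ψ : A → Carrier} →
                (∀ x → x ∈ xs → φ x ≈ ψ x) → lsum xs φ ≈ lsum xs ψ
    lsum-cong []       _   = refl
    lsum-cong (x ∷ xs) φ≈ψ = ∙-cong (φ≈ψ x (here ≡.refl)) (lsum-cong xs (λ y → φ≈ψ y ∘ there))

    lsum-ε : ∀ (xs : List A) {φ : A → Carrier} → (∀ x → x ∈ xs → φ x ≈ ε) → lsum xs φ ≈ ε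
    lsum-ε []       _  = refl
    lsum-ε (x ∷ xs) φ≈ε = trans (∙-cong (φ≈ε x (here ≡.refl)) (lsum-ε xs (λ y → φ≈ε y ∘ there))) (identityˡ ε)

    lsum-filter : ∀ {q} {Q : Pred A q} (Q? : Decidable Q) (xs : List A) {φ : A → Carrier} →
                  (∀ x → x ∈ xs → ¬ Q x → φ x ≈ ε) → lsum xs φ ≈ lsum (filter Q? xs) φ
    lsum-filter Q? []       _   = refl
    lsum-filter Q? (x ∷ xs) φ≈ε with Q? x
    ... | yes _ = ∙-congˡ (lsum-filter Q? xs (λ y → φ≈ε y ∘ there))
    ... | no ¬q = trans (∙-congʳ (φ≈ε x (here ≡.refl) ¬q))
                    (trans (identityˡ _) (lsum-filter Q? xs (λ y → φ≈ε y ∘ there)))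

    lsum-lookup : ∀ (xs : List A) (φ : A → Carrier) → lsum xs φ ≈ MΣ.sum (φ ∘ lookup xs)
    lsum-lookup []       φ = refl
    lsum-lookup (x ∷ xs) φ = ∙-congˡ (lsum-lookup xs φ)

  module _ {a r} (S : Setoid a r) where
    open Setoid S using () renaming (Carrier to A; _≈_ to _≃_; sym to ≃-sym; trans to ≃-trans)
    open import Data.List.Membership.Setoid S using () renaming (_∈_ to _∈ₛ_)
    open import Data.List.Relation.Unary.Unique.Setoid S using (Unique)

    lsum-unique : ∀ {xs : List A} {φ : A → Carrier} x → Unique xs → x ∈ₛ xs →
                  (∀ y → y ∈ xs → ¬ y ≃ x → φ y ≈ ε) → (∀ {y} → y ≃ x → φ y ≈ φ x) →
                  lsum xs φ ≈ φ x
    lsum-unique {y ∷ ys} x (y≄ys ∷ _) (here x≃y) off resp =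
      trans (∙-cong (resp (≃-sym x≃y)) (lsum-ε ys λ z z∈ys → off z (there z∈ys) λ z≃x →
        All.lookup y≄ys z∈ys (≃-trans (≃-sym x≃y) (≃-sym z≃x)))) (identityʳ _)
    lsum-unique {y ∷ ys} x (y≄ys ∷ uniq) (there x∈ys) off resp =
      trans (∙-cong (off y (here ≡.refl) y≄x) (lsum-unique x uniq x∈ys (λ z → off z ∘ there) resp))
            (identityˡ _)
      where
      y≄x : ¬ y ≃ x
      y≄x y≃x with All.lookupAny y≄ys x∈ys
      ... | y≄z , x≃z = y≄z (≃-trans y≃x x≃z)

  module _ {k} (G : Subgroup k) where
    open Subgroup G
    open SubgroupProperties G

    private
      lookup-injective : ∀ {πs : List (Permutation′ k)} → AllPairs (λ π σ → ¬ (π ≈ₚ σ)) πs →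
                         ∀ i j → lookup πs i ≈ₚ lookup πs j → i ≡ j
      lookup-injective (_ ∷ _)    Fin.zero    Fin.zero    _ = ≡.refl
      lookup-injective (π≉ ∷ _)    Fin.zero    (Fin.suc j) e = ⊥-elim (All.lookup π≉ (∈-lookup j) e)
      lookup-injective (π≉ ∷ _)    (Fin.suc i) Fin.zero    e = ⊥-elim (All.lookup π≉ (∈-lookup i) (≡.sym ∘ e))
      lookup-injective (_ ∷ uniq) (Fin.suc i) (Fin.suc j) e = ≡.cong Fin.suc (lookup-injective uniq i j e)

      translate : ∀ {f} → InG f → Σ (Fin (length elems) → Fin (length elems))
                    λ σ → ∀ j i → lookup elems (σ j) ⟨$⟩ʳ i ≡ f (lookup elems j ⟨$⟩ʳ i)
      translate f∈G = (λ j → Any.index (proj₁ (proj₂ (fg j)))) , λ j i →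
          ≡.trans (≡.cong (_⟨$⟩ʳ i) (≡.sym (lookup-index (proj₁ (proj₂ (fg j)))))) (proj₂ (proj₂ (fg j)) i)
        where
        fg = λ j → InG-∘ f∈G (⟨$⟩ʳ-InG (∈-lookup {xs = elems} j))

    lsum-∘-InG : ∀ {f} → InG f → (Ψ : (Fin k → Fin k) → Carrier) →
                 (∀ {h h′} → (∀ i → h i ≡ h′ i) → Ψ h ≈ Ψ h′) →
                 lsum elems (λ g → Ψ (f ∘ (g ⟨$⟩ʳ_))) ≈ lsum elems (λ g → Ψ (g ⟨$⟩ʳ_))
    lsum-∘-InG {f} f∈G Ψ Ψ-resp = begin
      lsum elems (λ g → Ψ (f ∘ (g ⟨$⟩ʳ_)))          ≈⟨ lsum-lookup elems _ ⟩
      MΣ.sum (λ j → Ψ (f ∘ (lookup elems j ⟨$⟩ʳ_)))   ≈⟨ MΣ.sum-cong-≋ (λ j → Ψ-resp (≡.sym ∘ σ-spec j)) ⟩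
      MΣ.sum (λ j → Ψ (lookup elems (σ j) ⟨$⟩ʳ_))     ≈⟨ sym (MΣ.sum-permute _ π) ⟩
      MΣ.sum (λ j → Ψ (lookup elems j ⟨$⟩ʳ_))         ≈⟨ sym (lsum-lookup elems _) ⟩
      lsum elems (λ g → Ψ (g ⟨$⟩ʳ_))                ∎
      where
      open Inverse (InG-inverse f∈G)
      σ  = proj₁ (translate f∈G)
      σ-spec = proj₂ (translate f∈G)
      σ′ = proj₁ (translate f⁻¹-InG)
      σ′-spec = proj₂ (translate f⁻¹-InG)
      π : Permutation′ (length elems)
      π = Perm.permutation σ σ′
        (λ j → lookup-injective distinct _ _ λ i →
          ≡.trans (σ-spec (σ′ j) i) (≡.trans (≡.cong f (σ′-spec j i)) (f∘f⁻¹ _)))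
        (λ j → lookup-injective distinct _ _ λ i →
          ≡.trans (σ′-spec (σ j) i) (≡.trans (≡.cong f⁻¹ (σ-spec j i)) (f⁻¹∘f _)))

module WordOrder {k n : ℕ} (G : Subgroup k) where
  open Subgroup G
  open SubgroupProperties G

  W : Set
  W = Word k n

  -- _≼_ and “same G-orbit”, with the permutation of positions given by any function realised in G
  record _⊑_ (x y : W) : Set where
    constructor ⊑-by
    field
      {perm} : Fin k → Fin k
      perm-InG : InG perm
      below    : ∀ i → x i ≤ᶠ y (perm i)

  record _∼_ (x y : W) : Set where
    constructor ∼-by
    field
      {perm} : Fin k → Fin k
      perm-InG : InG perm
      equal    : ∀ i → x i ≡ y (perm i)

  ⊑-refl : ∀ {x} → x ⊑ x
  ⊑-refl = ⊑-by InG-id (λ _ → FinP.≤-refl)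

  ⊑-trans : ∀ {x y z} → x ⊑ y → y ⊑ z → x ⊑ z
  ⊑-trans (⊑-by f∈G x≤y) (⊑-by g∈G y≤z) = ⊑-by (InG-∘ g∈G f∈G) λ i → FinP.≤-trans (x≤y i) (y≤z _)

  ⊑-respˡ : ∀ {x x′ y} → x ≗w x′ → x ⊑ y → x′ ⊑ y
  ⊑-respˡ x≗x′ (⊑-by f∈G x≤y) = ⊑-by f∈G λ i → ≡.subst (_≤ᶠ _) (x≗x′ i) (x≤y i)

  ∼-refl : ∀ {x} → x ∼ x
  ∼-refl = ∼-by InG-id (λ _ → ≡.refl)

  ≗⇒∼ : ∀ {x y} → x ≗w y → x ∼ y
  ≗⇒∼ = ∼-by InG-id

  ∼-sym : ∀ {x y} → x ∼ y → y ∼ x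
  ∼-sym {x} {y} (∼-by f∈G x≡y) = ∼-by f⁻¹-InG λ i → ≡.trans (≡.cong y (≡.sym (f∘f⁻¹ i))) (≡.sym (x≡y _))
    where open Inverse (InG-inverse f∈G)

  ∼-trans : ∀ {x y z} → x ∼ y → y ∼ z → x ∼ z
  ∼-trans (∼-by f∈G x≡y) (∼-by g∈G y≡z) = ∼-by (InG-∘ g∈G f∈G) λ i → ≡.trans (x≡y i) (y≡z _)

  ∼⇒⊑ : ∀ {x y} → x ∼ y → x ⊑ y
  ∼⇒⊑ (∼-by f∈G x≡y) = ⊑-by f∈G (FinP.≤-reflexive ∘ x≡y)

  ≼⇒⊑ : ∀ {x y} → _≼_ G x y → x ⊑ y
  ≼⇒⊑ (g , g∈G , x≤gy) = ⊑-by (⟨$⟩ˡ-InG g∈G) x≤gy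

  ⊑⇒≼ : ∀ {x y} → x ⊑ y → _≼_ G x y
  ⊑⇒≼ {x} {y} (⊑-by f∈G x≤y) with InG⇒⟨$⟩ˡ f∈G
  ... | g , g∈G , g≗f = g , g∈G , λ i → ≡.subst (λ j → x i ≤ᶠ y j) (≡.sym (g≗f i)) (x≤y i)

  ≼-refl : ∀ {x} → _≼_ G x x
  ≼-refl {x} = ⊑⇒≼ {x} {x} ⊑-refl

  ≼-trans : ∀ {x y z} → _≼_ G x y → _≼_ G y z → _≼_ G x z
  ≼-trans {x} {y} {z} x≼y y≼z = ⊑⇒≼ {x} {z} (⊑-trans (≼⇒⊑ {x} {y} x≼y) (≼⇒⊑ {y} {z} y≼z))

  act-∼ : ∀ {g} w → g ∈ elems → act g w ∼ w
  act-∼ w g∈G = ∼-by (⟨$⟩ˡ-InG g∈G) λ _ → ≡.refl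

  ∼⇒act : ∀ {u w} → u ∼ w → ∃[ g ] (g ∈ elems × u ≗w act g w)
  ∼⇒act {u} {w} (∼-by f∈G u≡w) with InG⇒⟨$⟩ˡ f∈G
  ... | g , g∈G , g≗f = g , g∈G , λ i → ≡.trans (u≡w i) (≡.cong w (≡.sym (g≗f i)))

  _⊑?_ : ∀ x y → Dec (x ⊑ y)
  x ⊑? y with any? (λ g → FinP.all? (λ i → x i FinP.≤? y (g ⟨$⟩ʳ i))) elems
  ... | yes some with find some
  ...   | g , g∈G , x≤gy = yes (⊑-by (⟨$⟩ʳ-InG g∈G) x≤gy)
  x ⊑? y | no none = no λ { (⊑-by (τ , τ∈G , τ≗f) x≤y) →
    none (lose τ∈G λ i → ≡.subst (λ j → x i ≤ᶠ y j) (≡.sym (τ≗f i)) (x≤y i)) }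

  _∼?_ : ∀ x y → Dec (x ∼ y)
  x ∼? y with any? (λ g → FinP.all? (λ i → x i FinP.≟ y (g ⟨$⟩ʳ i))) elems
  ... | yes some with find some
  ...   | g , g∈G , x≡gy = yes (∼-by (⟨$⟩ʳ-InG g∈G) x≡gy)
  x ∼? y | no none = no λ { (∼-by (τ , τ∈G , τ≗f) x≡y) →
    none (lose τ∈G λ i → ≡.trans (x≡y i) (≡.cong y (≡.sym (τ≗f i)))) }

  weight : W → ℕ
  weight x = ℕΣ.sum (toℕ ∘ x)

  weight-∘-InG : ∀ {f} → InG f → (x : W) → weight (x ∘ f) ≡ weight x
  weight-∘-InG {f} f∈G x = ≡.sym (ℕΣ.sum-permute (toℕ ∘ x) (Perm.permutation f f⁻¹ f∘f⁻¹ f⁻¹∘f))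
    where open Inverse (InG-inverse f∈G)

  weight-mono : ∀ {x y} → x ⊑ y → weight x ≤ weight y
  weight-mono {y = y} (⊑-by f∈G x≤y) = ℕP.≤-trans (sum-mono-≤ x≤y) (ℕP.≤-reflexive (weight-∘-InG f∈G y))

  weight≤bound : ∀ x → weight x ≤ ℕΣ.sum {k} (λ _ → n)
  weight≤bound x = sum-mono-≤ (λ i → ℕP.<⇒≤ (FinP.toℕ<n (x i)))

  ⊑-≡-weight⇒∼ : ∀ {x y} → x ⊑ y → weight x ≡ weight y → x ∼ y
  ⊑-≡-weight⇒∼ {y = y} (⊑-by f∈G x≤y) wx≡wy = ∼-by f∈G λ i →
    FinP.toℕ-injective (sum-mono-≤-≡⇒≡ x≤y (≡.trans wx≡wy (≡.sym (weight-∘-InG f∈G y))) i)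

  ⊑-antisym : ∀ {x y} → x ⊑ y → y ⊑ x → x ∼ y
  ⊑-antisym x⊑y y⊑x = ⊑-≡-weight⇒∼ x⊑y (ℕP.≤-antisym (weight-mono x⊑y) (weight-mono y⊑x))

  weight-strict : ∀ {x y} → x ⊑ y → ¬ y ⊑ x → weight x < weight y
  weight-strict x⊑y y⋢x with ℕP.m≤n⇒m<n∨m≡n (weight-mono x⊑y)
  ... | inj₁ lt = lt
  ... | inj₂ eq = ⊥-elim (y⋢x (∼⇒⊑ (∼-sym (⊑-≡-weight⇒∼ x⊑y eq))))

  moves-up : ∀ {f} (x : W) → InG f → ¬ (x ∘ f) ≗w x → ∃[ i ] (x i <ᶠ x (f i))
  moves-up {f} x f∈G x∘f≢x with FinP.any? (λ i → x i FinP.<? x (f i))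
  ... | yes up = up
  ... | no ¬up = ⊥-elim (x∘f≢x λ i → FinP.toℕ-injective
          (sum-mono-≤-≡⇒≡ (λ j → ℕP.≮⇒≥ (λ lt → ¬up (j , lt))) (weight-∘-InG f∈G x) i))

module OrbitRepresentatives {k n : ℕ} (G : Subgroup k) where
  open Subgroup G
  open WordOrder {k} {n} G

  _<L_ : W → W → Set
  _<L_ = _<lex_ G

  first-difference : ∀ {m} (x y : Fin m → Fin n) →
    (∀ i → x i ≡ y i) ⊎ ∃[ i ] ((∀ j → j <ᶠ i → x j ≡ y j) × ¬ x i ≡ y i)
  first-difference {zero} x y = inj₁ λ ()
  first-difference {suc m} x y with x Fin.zero FinP.≟ y Fin.zero
  ... | no x₀≢y₀ = inj₂ (Fin.zero , (λ _ ()) , x₀≢y₀)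
  ... | yes x₀≡y₀ with first-difference (x ∘ Fin.suc) (y ∘ Fin.suc)
  ...   | inj₁ tail≡ = inj₁ λ { Fin.zero → x₀≡y₀ ; (Fin.suc i) → tail≡ i }
  ...   | inj₂ (i , before , xi≢yi) = inj₂ (Fin.suc i , before′ , xi≢yi)
    where
    before′ : ∀ j → j <ᶠ Fin.suc i → x j ≡ y j
    before′ Fin.zero    _           = x₀≡y₀
    before′ (Fin.suc j) (ℕ.s≤s j<i) = before j j<i

  lex-irrefl : ∀ {x y} → x ≗w y → ¬ x <L y
  lex-irrefl x≗y (i , _ , lt) = FinP.<-irrefl (x≗y i) lt

  lex-trans : ∀ {x y z} → x <L y → y <L z → x <L z
  lex-trans {x} {y} {z} (i , before₁ , lt₁) (j , before₂ , lt₂) with FinP.<-cmp i j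
  ... | tri< i<j _ _ =
        i , (λ l l<i → ≡.trans (before₁ l l<i) (before₂ l (FinP.<-trans l<i i<j))) ,
        ≡.subst (x i <ᶠ_) (before₂ i i<j) lt₁
  ... | tri≈ _ ≡.refl _ = i , (λ l l<i → ≡.trans (before₁ l l<i) (before₂ l l<i)) , FinP.<-trans lt₁ lt₂
  ... | tri> _ _ j<i =
        j , (λ l l<j → ≡.trans (before₁ l (FinP.<-trans l<j j<i)) (before₂ l l<j)) ,
        ≡.subst (_<ᶠ z j) (≡.sym (before₁ j j<i)) lt₂

  lex-asym : ∀ {x y} → x <L y → ¬ y <L x
  lex-asym x<y y<x = lex-irrefl (λ _ → ≡.refl) (lex-trans x<y y<x)

  lex-respʳ : ∀ {x y y′} → y ≗w y′ → x <L y → x <L y′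
  lex-respʳ {x} y≗y′ (i , before , lt) =
    i , (λ j j<i → ≡.trans (before j j<i) (y≗y′ j)) , ≡.subst (x i <ᶠ_) (y≗y′ i) lt

  lex-respˡ : ∀ {x x′ y} → x ≗w x′ → x <L y → x′ <L y
  lex-respˡ {y = y} x≗x′ (i , before , lt) =
    i , (λ j j<i → ≡.trans (≡.sym (x≗x′ j)) (before j j<i)) , ≡.subst (_<ᶠ y i) (x≗x′ i) lt

  lex-compare : Trichotomous _≗w_ _<L_
  lex-compare x y with first-difference x y
  ... | inj₁ x≗y = tri≈ (lex-irrefl x≗y) x≗y (lex-irrefl (≡.sym ∘ x≗y))
  ... | inj₂ (i , before , xi≢yi) with FinP.<-cmp (x i) (y i)
  ...   | tri< lt _ _ = tri< x<y (λ x≗y → xi≢yi (x≗y i)) (lex-asym x<y)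
    where x<y = i , before , lt
  ...   | tri≈ _ eq _ = ⊥-elim (xi≢yi eq)
  ...   | tri> _ _ gt = tri> (lex-asym y<x) (λ x≗y → xi≢yi (x≗y i)) y<x
    where y<x = i , (λ j j<i → ≡.sym (before j j<i)) , gt

  lexStrictTotalOrder : StrictTotalOrder 0ℓ 0ℓ 0ℓ
  lexStrictTotalOrder = record
    { Carrier            = W
    ; _≈_                = _≗w_
    ; _<_                = _<L_
    ; isStrictTotalOrder = record
      { isStrictPartialOrder = record
        { isEquivalence = record
          { refl  = λ _ → ≡.refl
          ; sym   = λ x≗y i → ≡.sym (x≗y i)
          ; trans = λ x≗y y≗z i → ≡.trans (x≗y i) (y≗z i)
          }
        ; irrefl   = lex-irrefl
        ; trans    = lex-trans
        ; <-resp-≈ = lex-respʳ , lex-respˡ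
        }
      ; compare = lex-compare
      }
    }

  open DecTotalOrder (StrictTotalOrderProperties.decTotalOrder lexStrictTotalOrder) public
    using () renaming (_≤?_ to _≤L?_; antisym to ≤L-antisym; trans to ≤L-trans; totalOrder to lexTotalOrder;
                       module Eq to WordEq)
  private module LexMin = Extrema lexTotalOrder

  orbit : W → List W
  orbit w = map (λ g → act g w) elems

  canon : W → W
  canon w = LexMin.min w (orbit w)

  canon-∼ : ∀ w → canon w ∼ w
  canon-∼ w with LexMin.argmin-sel id w (orbit w)
  ... | inj₁ canon≡w = ≡.subst (_∼ w) (≡.sym canon≡w) ∼-refl
  ... | inj₂ canon∈orbit with ∈-map⁻ (λ g → act g w) canon∈orbit
  ...   | g , g∈G , canon≡gw = ≡.subst (_∼ w) (≡.sym canon≡gw) (act-∼ w g∈G)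

  canon-least : ∀ {u w} → u ∼ w → _≤lex_ G (canon w) u
  canon-least {w = w} u∼w with ∼⇒act u∼w
  ... | g , g∈G , u≗gw = ≤L-trans (All.lookup (LexMin.min≤xs w (orbit w)) (∈-map⁺ (λ g → act g w) g∈G))
                                  (inj₂ (≡.sym ∘ u≗gw))

  canon-InB : ∀ w → InB G (canon w)
  canon-InB w g g∈G = canon-least (∼-trans (act-∼ (canon w) g∈G) (canon-∼ w))

  InB-∼⇒≗ : ∀ {x y} → InB G x → InB G y → x ∼ y → x ≗w y
  InB-∼⇒≗ Bx By x∼y with ∼⇒act x∼y | ∼⇒act (∼-sym x∼y)
  ... | g , g∈G , x≗gy | g′ , g′∈G , y≗g′x =
    ≤L-antisym (≤L-trans (Bx g′ g′∈G) (inj₂ (≡.sym ∘ y≗g′x))) (≤L-trans (By g g∈G) (inj₂ (≡.sym ∘ x≗gy)))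

  InB? : ∀ y → Dec (InB G y)
  InB? y with all? (λ g → y ≤L? act g y) elems
  ... | yes all≤ = yes λ g g∈G → All.lookup all≤ g∈G
  ... | no ¬all≤ = no λ By → ¬all≤ (All.tabulate λ {g} → By g)

  InB-resp : ∀ {y y′} → y ≗w y′ → InB G y → InB G y′
  InB-resp y≗y′ By g g∈G = ≤L-trans (inj₂ (≡.sym ∘ y≗y′)) (≤L-trans (By g g∈G) (inj₂ (λ i → y≗y′ _)))

  words : ∀ m → List (Fin m → Fin n)
  words zero    = (λ ()) ∷ []
  words (suc m) = concatMap (λ a → map (cons a) (words m)) (allFin n)
    where
    cons : Fin n → (Fin m → Fin n) → Fin (suc m) → Fin n
    cons a w Fin.zero    = a
    cons a w (Fin.suc i) = w i

  words-complete : ∀ {m} (w : Fin m → Fin n) → Any (w ≗w_) (words m)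
  words-complete {zero}  w = here λ ()
  words-complete {suc m} w with find (words-complete (w ∘ Fin.suc))
  ... | y , y∈words , tail≗y = lose
        (∈-concatMap⁺ _ (lose (∈-allFin (w Fin.zero)) (∈-map⁺ _ y∈words)))
        λ { Fin.zero → ≡.refl ; (Fin.suc i) → tail≗y i }

  allWords : List W
  allWords = deduplicate WordEq._≟_ (words k)

  open import Data.List.Relation.Unary.Unique.Setoid WordEq.setoid public using (Unique)

  allWords-unique : Unique allWords
  allWords-unique = UniqueProperties.deduplicate-! WordEq.decSetoid (words k)

  allWords-complete : ∀ w → Any (w ≗w_) allWords
  allWords-complete w = deduplicate⁺ WordEq._≟_ (λ y≗y′ w≗y i → ≡.trans (w≗y i) (≡.sym (y≗y′ i)))
                                 (words-complete w)

module FieldLemmas {c ℓ} (F : Field c ℓ) where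
  open Field F
  open LinAlg F
  open import Relation.Binary.Reasoning.Setoid setoid
  open ListSum +-commutativeMonoid public

  ≉0-resp : ∀ {a b} → a ≈ b → ¬ a ≈ 0# → ¬ b ≈ 0#
  ≉0-resp a≈b a≉0 b≈0 = a≉0 (trans a≈b b≈0)

  *-≉0 : ∀ {a b} → ¬ a ≈ 0# → ¬ b ≈ 0# → ¬ (a * b) ≈ 0#
  *-≉0 {a} {b} a≉0 b≉0 ab≈0 = b≉0 (begin
    b                     ≈⟨ sym (*-identityˡ b) ⟩
    1# * b                ≈⟨ *-congʳ (sym (trans (*-comm _ _) (inverse a a≉0))) ⟩
    ((a ⁻¹) a≉0 * a) * b  ≈⟨ *-assoc _ _ _ ⟩
    (a ⁻¹) a≉0 * (a * b)  ≈⟨ *-congˡ ab≈0 ⟩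
    (a ⁻¹) a≉0 * 0#       ≈⟨ zeroʳ _ ⟩
    0#                    ∎)

  ⁻¹-≉0 : ∀ a (a≉0 : ¬ a ≈ 0#) → ¬ (a ⁻¹) a≉0 ≈ 0#
  ⁻¹-≉0 a a≉0 a⁻¹≈0 = 1≉0 (begin
    1#              ≈⟨ sym (inverse a a≉0) ⟩
    a * (a ⁻¹) a≉0  ≈⟨ *-congˡ a⁻¹≈0 ⟩
    a * 0#          ≈⟨ zeroʳ _ ⟩
    0#              ∎)

  ⁻¹-cong : ∀ {a b} (a≉0 : ¬ a ≈ 0#) (b≉0 : ¬ b ≈ 0#) → a ≈ b → (a ⁻¹) a≉0 ≈ (b ⁻¹) b≉0
  ⁻¹-cong {a} {b} a≉0 b≉0 a≈b = begin
    (a ⁻¹) a≉0                       ≈⟨ sym (*-identityʳ _) ⟩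
    (a ⁻¹) a≉0 * 1#                  ≈⟨ *-congˡ (sym (inverse b b≉0)) ⟩
    (a ⁻¹) a≉0 * (b * (b ⁻¹) b≉0)    ≈⟨ sym (*-assoc _ _ _) ⟩
    ((a ⁻¹) a≉0 * b) * (b ⁻¹) b≉0    ≈⟨ *-congʳ (*-congˡ (sym a≈b)) ⟩
    ((a ⁻¹) a≉0 * a) * (b ⁻¹) b≉0    ≈⟨ *-congʳ (trans (*-comm _ _) (inverse a a≉0)) ⟩
    1# * (b ⁻¹) b≉0                  ≈⟨ *-identityˡ _ ⟩
    (b ⁻¹) b≉0                       ∎

  prod-cong : ∀ m {f g : Fin m → Carrier} → (∀ i → f i ≈ g i) → prodFin m f ≈ prodFin m g
  prod-cong zero    _   = refl
  prod-cong (suc m) f≈g = *-cong (f≈g Fin.zero) (prod-cong m (f≈g ∘ Fin.suc))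

  prod-≈0 : ∀ m {f : Fin m → Carrier} i → f i ≈ 0# → prodFin m f ≈ 0#
  prod-≈0 (suc m) Fin.zero    fi≈0 = trans (*-congʳ fi≈0) (zeroˡ _)
  prod-≈0 (suc m) (Fin.suc i) fi≈0 = trans (*-congˡ (prod-≈0 m i fi≈0)) (zeroʳ _)

  prod-≉0 : ∀ m {f : Fin m → Carrier} → (∀ i → ¬ f i ≈ 0#) → ¬ prodFin m f ≈ 0#
  prod-≉0 zero    _    = 1≉0
  prod-≉0 (suc m) f≉0 = *-≉0 (f≉0 Fin.zero) (prod-≉0 m (f≉0 ∘ Fin.suc))

  fromℕ-length-≉0 : CharZero → ∀ {a} {A : Set a} {x : A} {xs} → x ∈ xs → ¬ fromℕ (length xs) ≈ 0#
  fromℕ-length-≉0 cz {xs = _ ∷ xs} _ = cz (length xs)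

  module _ {a q} {A : Set a} {Q : Pred A q} (Q? : Decidable Q) where

    lsum-indicator : ∀ (xs : List A) {φ : A → Carrier} p →
                     (∀ x → x ∈ xs → Q x → φ x ≈ p) → (∀ x → x ∈ xs → ¬ Q x → φ x ≈ 0#) →
                     lsum xs φ ≈ fromℕ (length (filter Q? xs)) * p
    lsum-indicator []       p _     _     = sym (zeroˡ p)
    lsum-indicator (x ∷ xs) {φ} p on off with Q? x
    ... | yes q = begin
      φ x + lsum xs φ                            ≈⟨ +-cong (on x (here ≡.refl) q) rest ⟩
      p + fromℕ (length (filter Q? xs)) * p      ≈⟨ +-congʳ (sym (*-identityˡ p)) ⟩
      1# * p + fromℕ (length (filter Q? xs)) * p ≈⟨ sym (distribʳ p 1# _) ⟩
      fromℕ (suc (length (filter Q? xs))) * p    ∎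
      where rest = lsum-indicator xs p (λ y → on y ∘ there) (λ y → off y ∘ there)
    ... | no ¬q = trans (+-cong (off x (here ≡.refl) ¬q) rest) (+-identityˡ _)
      where rest = lsum-indicator xs p (λ y → on y ∘ there) (λ y → off y ∘ there)

    lsum-indicator-≉0 : CharZero → ∀ (xs : List A) {φ : A → Carrier} {p x} → ¬ p ≈ 0# → x ∈ xs → Q x →
                        (∀ x → x ∈ xs → Q x → φ x ≈ p) → (∀ x → x ∈ xs → ¬ Q x → φ x ≈ 0#) →
                        ¬ lsum xs φ ≈ 0#
    lsum-indicator-≉0 cz xs p≉0 x∈xs Qx on off =
      ≉0-resp (sym (lsum-indicator xs _ on off)) (*-≉0 (fromℕ-length-≉0 cz (∈-filter⁺ Q? x∈xs Qx)) p≉0)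

module Symmetrizer {c ℓ} (F : Field c ℓ) (cz : LinAlg.CharZero F) {k n : ℕ} (G : Subgroup k) where
  open Field F
  open LinAlg F
  open Sym cz {k} {n} G
  open Subgroup G
  open SubgroupProperties G
  open WordOrder {k} {n} G
  open OrbitRepresentatives {k} {n} G
  open FieldLemmas F
  open import Relation.Binary.Reasoning.Setoid setoid

  1/|G| : Carrier
  1/|G| = (fromℕ order ⁻¹) (order≉0 cz G)

  P-coordinate : ∀ T y → P T y ≈ 1/|G| * lsum elems (λ g → T (y ∘ (g ⟨$⟩ʳ_)))
  P-coordinate T y = *-congˡ (sumPerm-coordinate elems)
    where
    sumPerm-coordinate : ∀ gs → sumPerm gs T y ≈ lsum gs (λ g → T (y ∘ (g ⟨$⟩ʳ_)))
    sumPerm-coordinate []       = refl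
    sumPerm-coordinate (g ∷ gs) = +-congˡ (sumPerm-coordinate gs)

  P-≈0 : ∀ T y → (∀ g → g ∈ elems → T (y ∘ (g ⟨$⟩ʳ_)) ≈ 0#) → P T y ≈ 0#
  P-≈0 T y terms≈0 = trans (P-coordinate T y) (trans (*-congˡ (lsum-ε elems terms≈0)) (zeroʳ _))

  -- the sum over G counts p once per element of the stabiliser of y, which is nonzero in characteristic zero
  P-≉0 : ∀ T y {p} → ¬ p ≈ 0# →
         (∀ g → g ∈ elems → (y ∘ (g ⟨$⟩ʳ_)) ≗w y → T (y ∘ (g ⟨$⟩ʳ_)) ≈ p) →
         (∀ g → g ∈ elems → ¬ (y ∘ (g ⟨$⟩ʳ_)) ≗w y → T (y ∘ (g ⟨$⟩ʳ_)) ≈ 0#) →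
         ¬ P T y ≈ 0#
  P-≉0 T y p≉0 on off = ≉0-resp (sym (P-coordinate T y))
    (*-≉0 (⁻¹-≉0 _ _) (lsum-indicator-≉0 (λ g → (y ∘ (g ⟨$⟩ʳ_)) ≗w? y) cz elems p≉0
      (proj₁ (proj₂ has-id)) (λ i → ≡.cong y (proj₂ (proj₂ has-id) i)) on off))

  Invariant : Tensor k n → Set ℓ
  Invariant T = ∀ {w w′} → w ∼ w′ → T w ≈ T w′

  P-invariant : ∀ T → (∀ {z z′} → z ≗w z′ → T z ≈ T z′) → Invariant (P T)
  P-invariant T T-resp {y′} {y} (∼-by {f} f∈G y′≡y) = begin
    P T y′                                                 ≈⟨ P-coordinate T y′ ⟩
    1/|G| * lsum elems (λ g → T (y′ ∘ (g ⟨$⟩ʳ_)))          ≈⟨ *-congˡ (lsum-cong elems λ g _ → T-resp (λ i → y′≡y _)) ⟩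
    1/|G| * lsum elems (λ g → T (y ∘ f ∘ (g ⟨$⟩ʳ_)))       ≈⟨ *-congˡ (lsum-∘-InG G f∈G (λ h → T (y ∘ h))
                                                                (λ h≗h′ → T-resp (≡.cong y ∘ h≗h′))) ⟩
    1/|G| * lsum elems (λ g → T (y ∘ (g ⟨$⟩ʳ_)))           ≈⟨ sym (P-coordinate T y) ⟩
    P T y                                                  ∎

  e-≗ : ∀ {y z : W} → y ≗w z → e y z ≈ 1#
  e-≗ {y} {z} y≗z with y ≗w? z
  ... | yes _   = refl
  ... | no y≄z = ⊥-elim (y≄z y≗z)

  e-≄ : ∀ {y z : W} → ¬ y ≗w z → e y z ≈ 0#
  e-≄ {y} {z} y≄z with y ≗w? z
  ... | yes y≗z = ⊥-elim (y≄z y≗z)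
  ... | no _    = refl

  e-cong : ∀ {y y′ z z′ : W} → y ≗w y′ → z ≗w z′ → e y z ≈ e y′ z′
  e-cong {y} {y′} {z} {z′} y≗y′ z≗z′ with y ≗w? z | y′ ≗w? z′
  ... | yes _   | yes _    = refl
  ... | no _    | no _     = refl
  ... | yes y≗z | no y′≄z′ = ⊥-elim (y′≄z′ λ i → ≡.trans (≡.sym (y≗y′ i)) (≡.trans (y≗z i) (z≗z′ i)))
  ... | no y≄z  | yes y′≗z′ = ⊥-elim (y≄z λ i → ≡.trans (y≗y′ i) (≡.trans (y′≗z′ i) (≡.sym (z≗z′ i))))

  b-vanishes : ∀ {y w} → ¬ y ∼ w → b y w ≈ 0#
  b-vanishes y≁w = P-≈0 _ _ λ g g∈G → e-≄ λ y≗wg → y≁w (∼-by (⟨$⟩ʳ-InG g∈G) y≗wg)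

  b-diagonal-≉0 : ∀ y → ¬ b y y ≈ 0#
  b-diagonal-≉0 y = P-≉0 (e y) y 1≉0 (λ _ _ yg≗y → e-≗ (≡.sym ∘ yg≗y))
                                     (λ _ _ yg≄y → e-≄ (λ y≗yg → yg≄y (≡.sym ∘ y≗yg)))

  b-cong : ∀ {y y′ w w′} → y ≗w y′ → w ≗w w′ → b y w ≈ b y′ w′
  b-cong {y} {y′} {w} {w′} y≗y′ w≗w′ = begin
    b y w                                             ≈⟨ P-coordinate (e y) w ⟩
    1/|G| * lsum elems (λ g → e y (w ∘ (g ⟨$⟩ʳ_)))    ≈⟨ *-congˡ (lsum-cong elems λ _ _ → e-cong y≗y′ (w≗w′ ∘ _)) ⟩
    1/|G| * lsum elems (λ g → e y′ (w′ ∘ (g ⟨$⟩ʳ_)))  ≈⟨ sym (P-coordinate (e y′) w′) ⟩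
    b y′ w′                                           ∎

  b-invariant : ∀ y → Invariant (b y)
  b-invariant y = P-invariant (e y) (e-cong (λ _ → ≡.refl))

  lincomb-coordinate : ∀ L coef w → lincomb L coef w ≈ lsum L (λ y → coef y * b y w)
  lincomb-coordinate []      coef w = refl
  lincomb-coordinate (x ∷ L) coef w = +-congˡ (lincomb-coordinate L coef w)

  lincomb-vanishes : ∀ L coef {w} → (∀ y → y ∈ L → ¬ y ∼ w) → lincomb L coef w ≈ 0#
  lincomb-vanishes L coef {w} off = trans (lincomb-coordinate L coef w)
    (lsum-ε L λ y y∈L → trans (*-congˡ (b-vanishes (off y y∈L))) (zeroʳ _))

  ⊗-cong : ∀ v {z z′ : W} → z ≗w z′ → ⊗ v z ≈ ⊗ v z′
  ⊗-cong v z≗z′ = prod-cong k λ i → reflexive (≡.cong (v i) (z≗z′ i))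

  record IsLeadingWord (v : Fin k → Vec′ n) (μ : W) : Set ℓ where
    field
      leading-≉0 : ∀ i → ¬ v i (μ i) ≈ 0#
      above-≈0   : ∀ i j → μ i <ᶠ j → v i j ≈ 0#

  module _ {v : Fin k → Vec′ n} {μ : W} (μ-leading : IsLeadingWord v μ) where
    open IsLeadingWord μ-leading

    P⊗-leading-≉0 : ¬ P (⊗ v) μ ≈ 0#
    P⊗-leading-≉0 = P-≉0 (⊗ v) μ (prod-≉0 k leading-≉0)
      (λ _ _ μg≗μ → ⊗-cong v μg≗μ)
      (λ g g∈G μg≄μ → let i , up = moves-up μ (⟨$⟩ʳ-InG g∈G) μg≄μ in prod-≈0 k i (above-≈0 i _ up))

    P⊗-vanishes : ∀ {w} → ¬ w ⊑ μ → P (⊗ v) w ≈ 0#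
    P⊗-vanishes {w} w⋢μ = P-≈0 (⊗ v) w λ g g∈G → vanishing-term g g∈G
      where
      vanishing-term : ∀ g → g ∈ elems → ⊗ v (w ∘ (g ⟨$⟩ʳ_)) ≈ 0#
      vanishing-term g g∈G with FinP.all? (λ i → w (g ⟨$⟩ʳ i) FinP.≤? μ i)
      ... | yes wg≤μ = ⊥-elim (w⋢μ (⊑-by f⁻¹-InG λ j → ≡.subst (λ u → w u ≤ᶠ μ (f⁻¹ j)) (f∘f⁻¹ j) (wg≤μ (f⁻¹ j))))
        where open Inverse (InG-inverse (⟨$⟩ʳ-InG g∈G))
      ... | no ¬wg≤μ = let i , wg≰μ = FinP.¬∀⟶∃¬ k _ (λ i → w (g ⟨$⟩ʳ i) FinP.≤? μ i) ¬wg≤μ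
                       in prod-≈0 k i (above-≈0 i _ (ℕP.≰⇒> wg≰μ))

  -- vanishing of a field element is not decidable, so the last nonzero entry exists only double-negatively
  ¬¬-leading-word : ∀ (v : Fin k → Vec′ n) → (∀ i → NonZero (v i)) → ¬ ¬ ∃ (IsLeadingWord v)
  ¬¬-leading-word v v≢0 = ¬¬-map leading
    (¬¬-∀Fin k λ i → ¬¬-map (last-nonzero (v i) (v≢0 i)) (¬¬-∀Fin n λ _ → ¬¬-excluded-middle))
    where
    last-nonzero : ∀ (u : Vec′ n) → NonZero u → (∀ j → Dec (u j ≈ 0#)) →
                   ∃[ m ] (¬ u m ≈ 0# × ∀ j → m <ᶠ j → u j ≈ 0#)
    last-nonzero u u≢0 u≈0? with last-index (λ j → ¬? (u≈0? j)) u≢0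
    ... | m , um≉0 , above = m , um≉0 , λ j m<j → decidable-stable (u≈0? j) (above j m<j)
    leading : (∀ i → ∃[ m ] (¬ v i m ≈ 0# × ∀ j → m <ᶠ j → v i j ≈ 0#)) → ∃ (IsLeadingWord v)
    leading rows = proj₁ ∘ rows , record
      { leading-≉0 = proj₁ ∘ proj₂ ∘ rows
      ; above-≈0   = proj₂ ∘ proj₂ ∘ rows
      }

  InSpan-mono : ∀ {J J′ : W → Set} {T} → (∀ x → J x → J′ x) → InSpan J T → InSpan J′ T
  InSpan-mono J⊆J′ (L , coef , L⊆J , T≈) = L , coef , (λ x → J⊆J′ x ∘ L⊆J x) , T≈

  lincomb-vanishes-on-orbit : ∀ L coef {i w} → InB G i → (∀ y → y ∈ L → InB G y × ¬ y ≗w i) →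
                              w ∼ i → lincomb L coef w ≈ 0#
  lincomb-vanishes-on-orbit L coef Bi L-off w∼i = lincomb-vanishes L coef λ y y∈L y∼w →
    proj₂ (L-off y y∈L) (InB-∼⇒≗ (proj₁ (L-off y y∈L)) Bi (∼-trans y∼w w∼i))

  InSpan-remove : ∀ {J : W → Set} {T i} → (∀ y → J y → InB G y) → InB G i →
                  (∀ w → w ∼ i → T w ≈ 0#) → InSpan J T → InSpan (remove G J i) T
  InSpan-remove {J} {T} {i} J⊆B Bi T-off (L , coef , L⊆J , T≈) = L′ , coef , L′⊆J∖i , T≈′
    where
    ≄i? : Decidable (λ y → ¬ y ≗w i)
    ≄i? y = ¬? (y ≗w? i)
    L′ = filter ≄i? L
    L′⊆J∖i : ∀ y → y ∈ L′ → remove G J i y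
    L′⊆J∖i y y∈L′ = let y∈L , y≄i = ∈-filter⁻ ≄i? {xs = L} y∈L′ in L⊆J y y∈L , y≄i
    T≈′ : T ≈T lincomb L′ coef
    T≈′ w with w ∼? i
    ... | yes w∼i = trans (T-off w w∼i) (sym (lincomb-vanishes-on-orbit L′ coef Bi
            (λ y y∈L′ → J⊆B y (proj₁ (L′⊆J∖i y y∈L′)) , proj₂ (L′⊆J∖i y y∈L′)) w∼i))
    ... | no w≁i = begin
      T w                                 ≈⟨ T≈ w ⟩
      lincomb L coef w                    ≈⟨ lincomb-coordinate L coef w ⟩
      lsum L (λ y → coef y * b y w)       ≈⟨ lsum-filter ≄i? L removed-terms-vanish ⟩
      lsum L′ (λ y → coef y * b y w)      ≈⟨ sym (lincomb-coordinate L′ coef w) ⟩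
      lincomb L′ coef w                   ∎
      where
      removed-terms-vanish : ∀ y → y ∈ L → ¬ ¬ y ≗w i → coef y * b y w ≈ 0#
      removed-terms-vanish y _ ¬y≄i = trans (*-congˡ (b-vanishes λ y∼w →
        w≁i (∼-trans (∼-sym y∼w) (≗⇒∼ (decidable-stable (y ≗w? i) ¬y≄i))))) (zeroʳ _)

  InSpan-remove-vanishes : ∀ {J : W → Set} {T x} → (∀ y → J y → InB G y) → InB G x →
                           InSpan (remove G J x) T → T x ≈ 0#
  InSpan-remove-vanishes J⊆B Bx (L , coef , L⊆J∖x , T≈) = trans (T≈ _)
    (lincomb-vanishes-on-orbit L coef Bx (λ y y∈L → J⊆B y (proj₁ (L⊆J∖x y y∈L)) , proj₂ (L⊆J∖x y y∈L)) ∼-refl)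

  -- the coefficient of P(e_y) is T(y) / P(e_y)(y); invariance of T makes the fit exact on the whole orbit of y
  invariant-InSpan : ∀ {J : W → Set} {T} (J? : Decidable J) → (∀ {y y′} → y ≗w y′ → J y → J y′) →
                     (∀ y → J y → InB G y) → Invariant T → (∀ w → ¬ J (canon w) → T w ≈ 0#) → InSpan J T
  invariant-InSpan {J} {T} J? J-resp J⊆B T-inv T-off = L , coef , L⊆J , T≈
    where
    L = filter J? allWords
    L⊆J : ∀ y → y ∈ L → J y
    L⊆J y y∈L = proj₂ (∈-filter⁻ J? {xs = allWords} y∈L)
    coef : W → Carrier
    coef y = T y * (b y y ⁻¹) (b-diagonal-≉0 y)
    T≈ : T ≈T lincomb L coef
    T≈ w with J? (canon w)
    ... | no ¬Ju = trans (T-off w ¬Ju) (sym (lincomb-vanishes L coef λ y y∈L y∼w →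
            ¬Ju (J-resp (InB-∼⇒≗ (J⊆B y (L⊆J y y∈L)) (canon-InB w) (∼-trans y∼w (∼-sym (canon-∼ w)))) (L⊆J y y∈L))))
    ... | yes Ju = sym (begin
      lincomb L coef w                           ≈⟨ lincomb-coordinate L coef w ⟩
      lsum L (λ y → coef y * b y w)              ≈⟨ lsum-unique WordEq.setoid u L-unique u∈L off resp ⟩
      coef u * b u w                             ≈⟨ *-assoc _ _ _ ⟩
      T u * ((b u u ⁻¹) _ * b u w)               ≈⟨ *-congˡ (*-congˡ (b-invariant u (∼-sym u∼w))) ⟩
      T u * ((b u u ⁻¹) _ * b u u)               ≈⟨ *-congˡ (trans (*-comm _ _) (inverse _ _)) ⟩
      T u * 1#                                   ≈⟨ *-identityʳ _ ⟩
      T u                                        ≈⟨ T-inv u∼w ⟩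
      T w                                        ∎)
      where
      u = canon w
      u∼w = canon-∼ w
      L-unique : Unique L
      L-unique = UniqueSetoid.filter⁺ WordEq.setoid J? allWords-unique
      u∈L : Any (u ≗w_) L
      u∈L with find (allWords-complete u)
      ... | y , y∈reps , u≗y = lose (∈-filter⁺ J? y∈reps (J-resp u≗y Ju)) u≗y
      off : ∀ y → y ∈ L → ¬ y ≗w u → coef y * b y w ≈ 0#
      off y y∈L y≄u = trans (*-congˡ (b-vanishes λ y∼w →
        y≄u (InB-∼⇒≗ (J⊆B y (L⊆J y y∈L)) (canon-InB w) (∼-trans y∼w (∼-sym u∼w))))) (zeroʳ _)
      resp : ∀ {y} → y ≗w u → coef y * b y w ≈ coef u * b u w
      resp y≗u = *-cong (*-cong (T-inv (≗⇒∼ y≗u)) (⁻¹-cong _ _ (b-cong y≗u y≗u))) (b-cong y≗u (λ _ → ≡.refl))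

module Classification {c ℓ} (F : Field c ℓ) (cz : LinAlg.CharZero F) {k n : ℕ} (G : Subgroup k) where
  open Field F using (_≈_; 0#; 1#; refl; trans; sym; 1≉0)
  open LinAlg F
  open Sym cz {k} {n} G
  open WordOrder {k} {n} G
  open OrbitRepresentatives {k} {n} G
  open Symmetrizer F cz {k} {n} G

  open BoundedHeight _⊑_ ⊑-refl ⊑-trans _⊑?_ weight (ℕΣ.sum {k} (λ _ → n)) weight≤bound weight-strict

  ↓-isOrderIdeal : ∀ x → IsOrderIdeal G (_↓ G x)
  ↓-isOrderIdeal x = (λ _ → proj₁) , λ y z By (_ , z≼x) y≼z → By , ≼-trans {y} {z} {x} y≼z z≼x

  staircase : W → Fin k → Vec′ n
  staircase x i j with j FinP.≤? x i
  ... | yes _ = 1#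
  ... | no _  = 0#

  staircase-leading : ∀ x → IsLeadingWord (staircase x) x
  staircase-leading x = record { leading-≉0 = on-diagonal ; above-≈0 = above }
    where
    on-diagonal : ∀ i → ¬ staircase x i (x i) ≈ 0#
    on-diagonal i with x i FinP.≤? x i
    ... | yes _  = 1≉0
    ... | no x≰x = ⊥-elim (x≰x FinP.≤-refl)
    above : ∀ i j → x i <ᶠ j → staircase x i j ≈ 0#
    above i j x<j with j FinP.≤? x i
    ... | yes j≤x = ⊥-elim (ℕP.<⇒≱ x<j j≤x)
    ... | no _    = refl

  module _ {I : W → Set} (I-ideal : IsOrderIdeal G I) where
    private
      I⊆B : ∀ y → I y → InB G y
      I⊆B = proj₁ I-ideal

    InC-below-leading : ∀ {v μ} → IsLeadingWord v μ → InC I (P (⊗ v)) → ∀ z → I z → z ⊑ μ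
    InC-below-leading {v} {μ} μ-leading (_ , T∈V_I , minimal) z Iz =
      decidable-stable (z ⊑? μ) λ z⋢μ → ¬¬-maximal-above I Iz λ { (i , z⊑i , Ii , i-maximal) →
        minimal i (Ii , λ j Ij i≼j → ⊑⇒≼ {j} {i} (i-maximal j Ij (≼⇒⊑ {i} {j} i≼j)))
          (InSpan-remove I⊆B (I⊆B i Ii) (λ w w∼i → P⊗-vanishes μ-leading λ w⊑μ →
            z⋢μ (⊑-trans z⊑i (⊑-trans (∼⇒⊑ (∼-sym w∼i)) w⊑μ))) T∈V_I) }

    ¬¬-dominated⇒IsPrincipal : ∀ {L} → (∀ y → y ∈ L → I y) →
                               ¬ ¬ (∃[ y₀ ] (y₀ ∈ L × ∀ z → I z → z ⊑ y₀)) → IsPrincipal G I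
    ¬¬-dominated⇒IsPrincipal {L} L⊆I dominated = x , I⊆B x (L⊆I x x∈L) , λ y By →
        (λ Iy → By , ⊑⇒≼ (decidable-stable (y ⊑? x) (¬¬-map (λ { (y₀ , y₀∈L , below) →
                          ⊑-trans (below y Iy) (All.lookup x-top y₀∈L) }) dominated)))
      , (λ { (_ , y≼x) → proj₂ I-ideal y x By (L⊆I x x∈L) y≼x })
      where
      top : ∃[ x ] (x ∈ L × All (_⊑ x) L)
      top = find (decidable-stable (any? (λ x → all? (_⊑? x) L) L) (¬¬-map (λ { (y₀ , y₀∈L , below) →
              lose y₀∈L (All.tabulate λ {y} y∈L → below y (L⊆I y y∈L)) }) dominated))
      x = proj₁ top
      x∈L = proj₁ (proj₂ top)
      x-top = proj₂ (proj₂ top)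

    MeetsGr⇒IsPrincipal : MeetsGr I → IsPrincipal G I
    MeetsGr⇒IsPrincipal (v , v≢0 , T∈C@(_ , (L , coef , L⊆I , T≈) , _)) =
      ¬¬-dominated⇒IsPrincipal L⊆I (¬¬-map dominating (¬¬-leading-word v v≢0))
      where
      dominating : ∃ (IsLeadingWord v) → ∃[ y₀ ] (y₀ ∈ L × ∀ z → I z → z ⊑ y₀)
      dominating (μ , μ-leading) with any? (_∼? μ) L
      ... | yes some = let y₀ , y₀∈L , y₀∼μ = find some in
            y₀ , y₀∈L , λ z Iz → ⊑-trans (InC-below-leading μ-leading T∈C z Iz) (∼⇒⊑ (∼-sym y₀∼μ))
      ... | no none = ⊥-elim (P⊗-leading-≉0 μ-leading
            (trans (T≈ μ) (lincomb-vanishes L coef λ y y∈L y∼μ → none (lose y∈L y∼μ))))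

    IsPrincipal⇒MeetsGr : IsPrincipal G I → MeetsGr I
    IsPrincipal⇒MeetsGr (x , Bx , I⇔x↓) =
      staircase x , (λ i → x i , leading-≉0 i) , (x , P⊗-leading-≉0 x-leading) , T∈V_I , minimal
      where
      x-leading = staircase-leading x
      open IsLeadingWord x-leading
      T = P (⊗ (staircase x))
      T-invariant : Invariant T
      T-invariant = P-invariant (⊗ (staircase x)) (⊗-cong (staircase x))
      T∈V_I : InSpan I T
      T∈V_I = InSpan-mono (λ y (By , y⊑x) → proj₂ (I⇔x↓ y By) (By , ⊑⇒≼ {y} {x} y⊑x))
        (invariant-InSpan (λ y → InB? y ×-dec (y ⊑? x)) (λ y≗y′ (By , y⊑x) → InB-resp y≗y′ By , ⊑-respˡ y≗y′ y⊑x)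
          (λ _ → proj₁) T-invariant λ w ¬below → P⊗-vanishes x-leading λ w⊑x →
            ¬below (canon-InB w , ⊑-trans (∼⇒⊑ (canon-∼ w)) w⊑x))
      minimal : ∀ i → IsMax G I i → ¬ InSpan (remove G I i) T
      minimal i (Ii , i-maximal) T∈V_I∖i =
        P⊗-leading-≉0 x-leading (trans (T-invariant (≗⇒∼ x≗i)) (InSpan-remove-vanishes I⊆B (I⊆B i Ii) T∈V_I∖i))
        where
        i≼x : _≼_ G i x
        i≼x = proj₂ (proj₁ (I⇔x↓ i (I⊆B i Ii)) Ii)
        Ix : I x
        Ix = proj₂ (I⇔x↓ x Bx) (Bx , ≼-refl {x})
        x≗i : x ≗w i
        x≗i = InB-∼⇒≗ Bx (I⊆B i Ii) (⊑-antisym (≼⇒⊑ {x} {i} (i-maximal x Ix i≼x)) (≼⇒⊑ {i} {x} i≼x))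

    MeetsGr⇔IsPrincipal : MeetsGr I ⇔ IsPrincipal G I
    MeetsGr⇔IsPrincipal = mk⇔ MeetsGr⇒IsPrincipal IsPrincipal⇒MeetsGr

  ↓-injective : ∀ {x x′} → InB G x → InB G x′ →
                (∀ y → InB G y → (_↓ G x y → _↓ G x′ y) × (_↓ G x′ y → _↓ G x y)) → x ≗w x′
  ↓-injective {x} {x′} Bx Bx′ same = InB-∼⇒≗ Bx Bx′ (⊑-antisym
    (≼⇒⊑ {x} {x′} (proj₂ (proj₁ (same x Bx) (Bx , ≼-refl {x}))))
    (≼⇒⊑ {x′} {x} (proj₂ (proj₂ (same x′ Bx′) (Bx′ , ≼-refl {x′})))))

  MeetingIdeal : Set (Level.suc 0ℓ ⊔ c ⊔ ℓ)
  MeetingIdeal = Σ (W → Set) (λ I → IsOrderIdeal G I × MeetsGr I)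

  generator : MeetingIdeal → Σ W (InB G)
  generator (I , I-ideal , meets) = let x , Bx , _ = MeetsGr⇒IsPrincipal I-ideal meets in x , Bx

  generator-↓ : ∀ (a : MeetingIdeal) y → InB G y →
                (proj₁ a y → _↓ G (proj₁ (generator a)) y) × (_↓ G (proj₁ (generator a)) y → proj₁ a y)
  generator-↓ (I , I-ideal , meets) = proj₂ (proj₂ (MeetsGr⇒IsPrincipal I-ideal meets))

  principal : Σ W (InB G) → MeetingIdeal
  principal (x , Bx) = _↓ G x , ↓-isOrderIdeal x , IsPrincipal⇒MeetsGr (↓-isOrderIdeal x) (x , Bx , λ _ _ → id , id)

  meetingIdeals≅B : OrderIso MeetingIdeal
    (λ I J → (∀ x → proj₁ I x → proj₁ J x) × (∀ x → proj₁ J x → proj₁ I x))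
    (λ I J → ∀ x → proj₁ I x → proj₁ J x)
    (Σ W (InB G))
    (λ x y → proj₁ x ≗w proj₁ y)
    (λ x y → _≼_ G (proj₁ x) (proj₁ y))
  meetingIdeals≅B = record
    { to      = generator
    ; from    = principal
    ; from-to = λ a → (λ z (Bz , z≼x) → proj₂ (generator-↓ a z Bz) (Bz , z≼x))
                    , (λ z Iz → proj₁ (generator-↓ a z (I⊆B a z Iz)) Iz)
    ; to-from = λ { (x , Bx) → ↓-injective (proj₂ (generator (principal (x , Bx)))) Bx
                                 (λ y By → swap (generator-↓ (principal (x , Bx)) y By)) }
    ; mono    = λ a a′ I⊆I′ → let x , Bx = generator a in
                proj₂ (proj₁ (generator-↓ a′ x Bx) (I⊆I′ x (proj₂ (generator-↓ a x Bx) (Bx , ≼-refl {x}))))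
    ; reflect = λ a a′ x≼x′ z Iz → let Bz = I⊆B a z Iz in proj₂ (generator-↓ a′ z Bz)
                (Bz , ≼-trans {z} {proj₁ (generator a)} {proj₁ (generator a′)}
                        (proj₂ (proj₁ (generator-↓ a z Bz) Iz)) x≼x′)
    }
    where
    I⊆B : ∀ (a : MeetingIdeal) z → proj₁ a z → InB G z
    I⊆B (_ , I-ideal , _) = proj₁ I-ideal

proposition6p1 : ∀ {c ℓ : Level} (F : Field c ℓ) (cz : LinAlg.CharZero F) →
    (k n : ℕ) → 1 ≤ k → 1 ≤ n → (G : Subgroup k) →
    let module S = LinAlg.Sym F cz {k} {n} G
    in (∀ (I : Word k n → Set) → IsOrderIdeal {k} {n} G I →
          (S.MeetsGr I ⇔ IsPrincipal {k} {n} G I))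
       × OrderIso
           (Σ (Word k n → Set) (λ I → IsOrderIdeal {k} {n} G I × S.MeetsGr I))
           (λ I J → (∀ x → proj₁ I x → proj₁ J x) × (∀ x → proj₁ J x → proj₁ I x))
           (λ I J → ∀ x → proj₁ I x → proj₁ J x)
           (Σ (Word k n) (InB {k} {n} G))
           (λ x y → proj₁ x ≗w proj₁ y)
           (λ x y → _≼_ {k} {n} G (proj₁ x) (proj₁ y))
proposition6p1 F cz k n _ _ G = (λ I → MeetsGr⇔IsPrincipal) , meetingIdeals≅B
  where open Classification F cz {k} {n} G
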